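{- Let $b\ge1$ and let $(t_1,\dots,t_b)$ be an admissible sequence with dual sequence $(T_1,\dots,T_b)$, $T_j=h(t_1,\dots,t_j)$. Then: (i) for each $1\le j\le b$, the product $\prod_{k=1}^jT_k$ is an integer; (ii) if $|\prod_{k=1}^bT_k|=1$ and either $T_b=1$ or $T_b<0$, then there exists a positive integer $t_{b+1}$ such that $(t_1,\dots,t_{b+1})$ is primitive; (iii) if $|\prod_{k=1}^bT_k|=1$ and either $T_b=\frac12$ or $T_b<0$, then there exists a positive integer $t_{b+1}$ such that $T_{b+1}:=2-t_{b+1}-1/T_b=-1$; (iv) if $|\prod_{k=1}^bT_k|=1$ and $T_b<0$, then there exists a positive integer $t_{b+1}$ such that $T_{b+1}:=2-t_{b+1}-1/T_b=1$.
   Context: For positive integers $t_1,t_2,\dots$ define rationals $h(t_1)=2-t_1$ and $h(t_1,\dots,t_j)=2-t_j-1/h(t_1,\dots,t_{j-1})$ for $j\ge2$. A sequence $(t_1,\dots,t_b)$ ($b\ge0$) of positive integers is admissible if $h(t_1),h(t_1,t_2),\dots,h(t_1,\dots,t_b)$ are all nonzero. A sequence $(t_1,\dots,t_{b+1})$ of positive integers is primitive if $(t_1,\dots,t_b)$ is admissible and $h(t_1,\dots,t_{b+1})=2-t_{b+1}-1/h(t_1,\dots,t_b)=0$. The dual sequence of $(t_1,\dots,t_b)$ is $(h(t_1),h(t_1,t_2),\dots,h(t_1,\dots,t_b))$. -}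

module Defs where

open import Data.Nat as ℕ using (ℕ; zero; suc)
open import Data.Integer as ℤ using (ℤ; +_)
open import Data.Rational using (ℚ; _/_; 0ℚ; 1ℚ; 1/_; _-_; _*_; ≢-nonZero)
open import Data.Rational.Properties using (_≟_)
open import Data.List using (List; []; _∷_; _++_)
open import Data.List.Relation.Unary.All using (All)
open import Data.Product using (∃; _×_)
open import Relation.Nullary using (yes; no; ¬_)
open import Relation.Binary.PropositionalEquality using (_≡_)

ℕ→ℚ : ℕ → ℚ
ℕ→ℚ n = + n / 1

ℤ→ℚ : ℤ → ℚ
ℤ→ℚ z = z / 1

-- reciprocal, totalised by 1/0 := 0.  It is only ever applied to a
-- nonzero argument in the notions below (admissibility guards it).
inv : ℚ → ℚ
inv q with q ≟ 0ℚ
... | yes _ = 0ℚ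
... | no q≢0 = 1/_ q {{≢-nonZero q≢0}}

-- one step:  h(t_1..t_j) = 2 - t_j - 1/h(t_1..t_{j-1})
hStep : ℚ → ℕ → ℚ
hStep T t = (ℕ→ℚ 2 - ℕ→ℚ t) - inv T

dualAux : ℚ → List ℕ → List ℚ
dualAux T [] = []
dualAux T (t ∷ ts) = hStep T t ∷ dualAux (hStep T t) ts

dual : List ℕ → List ℚ
dual [] = []
dual (t ∷ ts) = (ℕ→ℚ 2 - ℕ→ℚ t) ∷ dualAux (ℕ→ℚ 2 - ℕ→ℚ t) ts

-- last element (default 0ℚ for the empty list; only used on nonempty lists)
lastQ : List ℚ → ℚ
lastQ [] = 0ℚ
lastQ (x ∷ []) = x
lastQ (x ∷ y ∷ xs) = lastQ (y ∷ xs)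

productQ : List ℚ → ℚ
productQ [] = 1ℚ
productQ (x ∷ xs) = x * productQ xs

Positive : List ℕ → Set
Positive ts = All (λ t → 1 ℕ.≤ t) ts

Admissible : List ℕ → Set
Admissible ts = Positive ts × All (λ T → ¬ (T ≡ 0ℚ)) (dual ts)

IsInteger : ℚ → Set
IsInteger q = ∃ λ (z : ℤ) → q ≡ ℤ→ℚ z

Primitive : List ℕ → Set
Primitive s = ∃ λ (init : List ℕ) → ∃ λ (u : ℕ) →
  (s ≡ init ++ (u ∷ [])) × 1 ℕ.≤ u × Admissible init × lastQ (dual s) ≡ 0ℚ

{-# OPTIONS --safe #-}
module Submission where

-- Write P_j = T_1 ⋯ T_j (P_0 = 1, P_{-1} = 0). Since T_{j+1} = 2 − t_{j+1} − P_{j−1}/P_j,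
-- the products obey the integer recurrence P_{j+1} = (2 − t_{j+1}) P_j − P_{j−1}, so every
-- P_j is an integer and T_j = P_j / P_{j−1} is a ratio of integers.  If |P_b| = 1 then
-- 1/T_b = ± P_{b−1} is an integer, negative when T_b < 0, say −(k+1); then
-- 2 − t − 1/T_b = 3 + k − t, and t = k+3, k+4, k+2 give 0, −1, 1.

open import Defs
open import Data.Nat as ℕ using (ℕ; zero; suc; s≤s; z≤n)
open import Data.Integer as ℤ using (+_; -[1+_])
open import Data.Integer.Solver using () renaming (module +-*-Solver to ℤ-Solver)
open import Data.Rational as ℚ using (ℚ; mkℚ; _<_; 0ℚ; 1ℚ; ½; ∣_∣; -_; _+_; _-_; _*_; 1/_; toℚᵘ; Negative)
import Data.Rational.Properties as ℚ
open import Data.Rational.Solver using (module +-*-Solver)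
import Data.Rational.Unnormalised as ℚᵘ
import Data.Rational.Unnormalised.Properties as ℚᵘ
open import Data.List using (List; []; _∷_; length; take; _++_)
open import Data.List.Relation.Unary.All using (All; []; _∷_)
open import Data.List.Relation.Unary.All.Properties using (take⁺)
open import Data.Product using (∃; _×_; _,_)
open import Data.Sum using (_⊎_; inj₁; inj₂)
open import Data.Empty using (⊥-elim)
open import Relation.Nullary using (yes; no)
open import Relation.Binary.PropositionalEquality
  using (_≡_; _≢_; refl; sym; trans; cong; cong₂; subst; module ≡-Reasoning)

toℚᵘ-ℤ→ℚ : ∀ z → toℚᵘ (ℤ→ℚ z) ℚᵘ.≃ ℚᵘ.mkℚᵘ z 0
toℚᵘ-ℤ→ℚ z = ℚ.toℚᵘ-fromℚᵘ (ℚᵘ.mkℚᵘ z 0)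

ℤ→ℚ-homo-+ : ∀ a b → ℤ→ℚ (a ℤ.+ b) ≡ ℤ→ℚ a + ℤ→ℚ b
ℤ→ℚ-homo-+ a b = ℚ.toℚᵘ-injective (begin
  toℚᵘ (ℤ→ℚ (a ℤ.+ b))              ≈⟨ toℚᵘ-ℤ→ℚ (a ℤ.+ b) ⟩
  ℚᵘ.mkℚᵘ (a ℤ.+ b) 0               ≈⟨ ℚᵘ.*≡* (solve 2 (λ a b → (a :+ b) :* con (+ 1) := (a :* con (+ 1) :+ b :* con (+ 1)) :* con (+ 1)) refl a b) ⟩
  ℚᵘ.mkℚᵘ a 0 ℚᵘ.+ ℚᵘ.mkℚᵘ b 0       ≈⟨ ℚᵘ.+-cong (ℚᵘ.≃-sym (toℚᵘ-ℤ→ℚ a)) (ℚᵘ.≃-sym (toℚᵘ-ℤ→ℚ b)) ⟩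
  toℚᵘ (ℤ→ℚ a) ℚᵘ.+ toℚᵘ (ℤ→ℚ b)   ≈⟨ ℚᵘ.≃-sym (ℚ.toℚᵘ-homo-+ (ℤ→ℚ a) (ℤ→ℚ b)) ⟩
  toℚᵘ (ℤ→ℚ a + ℤ→ℚ b)              ∎)
  where open ℚᵘ.≃-Reasoning; open ℤ-Solver

ℤ→ℚ-homo-* : ∀ a b → ℤ→ℚ (a ℤ.* b) ≡ ℤ→ℚ a * ℤ→ℚ b
ℤ→ℚ-homo-* a b = ℚ.toℚᵘ-injective (begin
  toℚᵘ (ℤ→ℚ (a ℤ.* b))              ≈⟨ toℚᵘ-ℤ→ℚ (a ℤ.* b) ⟩
  ℚᵘ.mkℚᵘ (a ℤ.* b) 0               ≈⟨ ℚᵘ.*≡* refl ⟩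
  ℚᵘ.mkℚᵘ a 0 ℚᵘ.* ℚᵘ.mkℚᵘ b 0       ≈⟨ ℚᵘ.*-cong (ℚᵘ.≃-sym (toℚᵘ-ℤ→ℚ a)) (ℚᵘ.≃-sym (toℚᵘ-ℤ→ℚ b)) ⟩
  toℚᵘ (ℤ→ℚ a) ℚᵘ.* toℚᵘ (ℤ→ℚ b)   ≈⟨ ℚᵘ.≃-sym (ℚ.toℚᵘ-homo-* (ℤ→ℚ a) (ℤ→ℚ b)) ⟩
  toℚᵘ (ℤ→ℚ a * ℤ→ℚ b)              ∎)
  where open ℚᵘ.≃-Reasoning

ℤ→ℚ-homo-neg : ∀ a → ℤ→ℚ (ℤ.- a) ≡ - ℤ→ℚ a
ℤ→ℚ-homo-neg a = ℚ.toℚᵘ-injective (begin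
  toℚᵘ (ℤ→ℚ (ℤ.- a))   ≈⟨ toℚᵘ-ℤ→ℚ (ℤ.- a) ⟩
  ℚᵘ.mkℚᵘ (ℤ.- a) 0    ≈⟨ ℚᵘ.-‿cong (ℚᵘ.≃-sym (toℚᵘ-ℤ→ℚ a)) ⟩
  ℚᵘ.- toℚᵘ (ℤ→ℚ a)    ≈⟨ ℚᵘ.≃-sym (ℚ.toℚᵘ-homo‿- (ℤ→ℚ a)) ⟩
  toℚᵘ (- ℤ→ℚ a)       ∎)
  where open ℚᵘ.≃-Reasoning

ℕ→ℚ-homo-+ : ∀ m n → ℕ→ℚ (m ℕ.+ n) ≡ ℕ→ℚ m + ℕ→ℚ n
ℕ→ℚ-homo-+ m n = ℤ→ℚ-homo-+ (+ m) (+ n)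

isInteger-ℕ→ℚ : ∀ n → IsInteger (ℕ→ℚ n)
isInteger-ℕ→ℚ n = + n , refl

isInteger-1 : IsInteger 1ℚ
isInteger-1 = isInteger-ℕ→ℚ 1

isInteger-+ : ∀ {x y} → IsInteger x → IsInteger y → IsInteger (x + y)
isInteger-+ (a , refl) (b , refl) = a ℤ.+ b , sym (ℤ→ℚ-homo-+ a b)

isInteger-* : ∀ {x y} → IsInteger x → IsInteger y → IsInteger (x * y)
isInteger-* (a , refl) (b , refl) = a ℤ.* b , sym (ℤ→ℚ-homo-* a b)

isInteger-neg : ∀ {x} → IsInteger x → IsInteger (- x)
isInteger-neg (a , refl) = ℤ.- a , sym (ℤ→ℚ-homo-neg a)

isInteger-- : ∀ {x y} → IsInteger x → IsInteger y → IsInteger (x - y)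
isInteger-- ix iy = isInteger-+ ix (isInteger-neg iy)

isInteger-negative : ∀ {x} → IsInteger x → Negative x → ∃ λ k → x ≡ - ℕ→ℚ (suc k)
isInteger-negative (+ n , refl) neg =
  ⊥-elim (ℚ.nonNeg≢neg (ℤ→ℚ (+ n)) (ℤ→ℚ (+ n)) {{ℚ.normalize-nonNeg n 1}} {{neg}} refl)
isInteger-negative (-[1+ k ] , refl) _ = k , refl

∣q∣≡1⇒q≡±1 : ∀ q → ∣ q ∣ ≡ 1ℚ → q ≡ 1ℚ ⊎ q ≡ - 1ℚ
∣q∣≡1⇒q≡±1 (mkℚ (+ _) _ _) eq = inj₁ eq
∣q∣≡1⇒q≡±1 (mkℚ -[1+ 0 ] 0 _) refl = inj₂ refl

inv-inverseʳ : ∀ x → x ≢ 0ℚ → x * inv x ≡ 1ℚ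
inv-inverseʳ x x≢0 with x ℚ.≟ 0ℚ
... | yes x≡0 = ⊥-elim (x≢0 x≡0)
... | no  x≢0 = ℚ.*-inverseʳ x {{ℚ.≢-nonZero x≢0}}

inv-negative : ∀ x → x < 0ℚ → Negative (inv x)
inv-negative x x<0 with x ℚ.≟ 0ℚ
... | yes refl = ⊥-elim (ℚ.<-irrefl refl x<0)
... | no  _    = ℚ.1/neg⇒neg x {{ℚ.negative x<0}}

-- x = q / p with p, q integers; along the dual sequence q = P_j, p = P_{j−1}, x = T_j.
IntegralRatio : ℚ → ℚ → Set
IntegralRatio q x = ∃ λ p → IsInteger p × IsInteger q × p * x ≡ q

hStep-continuant : ∀ {p T} q t → p * T ≡ q → T ≢ 0ℚ → q * hStep T t ≡ (ℕ→ℚ 2 - ℕ→ℚ t) * q - p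
hStep-continuant {p} {T} q t refl T≢0 = begin
  (p * T) * ((ℕ→ℚ 2 - ℕ→ℚ t) - inv T)        ≡⟨ solve 4 (λ p T c i → (p :* T) :* (c :- i) := c :* (p :* T) :- p :* (T :* i)) refl p T (ℕ→ℚ 2 - ℕ→ℚ t) (inv T) ⟩
  (ℕ→ℚ 2 - ℕ→ℚ t) * (p * T) - p * (T * inv T) ≡⟨ cong (λ y → (ℕ→ℚ 2 - ℕ→ℚ t) * (p * T) - p * y) (inv-inverseʳ T T≢0) ⟩
  (ℕ→ℚ 2 - ℕ→ℚ t) * (p * T) - p * 1ℚ          ≡⟨ cong (λ y → (ℕ→ℚ 2 - ℕ→ℚ t) * (p * T) - y) (ℚ.*-identityʳ p) ⟩
  (ℕ→ℚ 2 - ℕ→ℚ t) * (p * T) - p              ∎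
  where open ≡-Reasoning; open +-*-Solver

integralRatio-hStep : ∀ {q T} t → IntegralRatio q T → T ≢ 0ℚ → IntegralRatio (q * hStep T t) (hStep T t)
integralRatio-hStep {q} t (p , ip , iq , pT≡q) T≢0 =
  q , iq , subst IsInteger (sym (hStep-continuant q t pT≡q T≢0))
             (isInteger-- (isInteger-* (isInteger-- (isInteger-ℕ→ℚ 2) (isInteger-ℕ→ℚ t)) iq) ip) , refl

integralRatio-dualAux : ∀ ts {q T} → IntegralRatio q T → All (_≢ 0ℚ) (T ∷ dualAux T ts) →
  IntegralRatio (q * productQ (dualAux T ts)) (lastQ (T ∷ dualAux T ts))
integralRatio-dualAux [] {q} r _ = subst (λ q′ → IntegralRatio q′ _) (sym (ℚ.*-identityʳ q)) r
integralRatio-dualAux (t ∷ ts) {q} {T} r (T≢0 ∷ nz) =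
  subst (λ q′ → IntegralRatio q′ _) (ℚ.*-assoc q (hStep T t) _)
    (integralRatio-dualAux ts (integralRatio-hStep t r T≢0) nz)

integralRatio-dual : ∀ t ts → All (_≢ 0ℚ) (dual (t ∷ ts)) →
  IntegralRatio (productQ (dual (t ∷ ts))) (lastQ (dual (t ∷ ts)))
integralRatio-dual t ts =
  integralRatio-dualAux ts (1ℚ , isInteger-1 , isInteger-- (isInteger-ℕ→ℚ 2) (isInteger-ℕ→ℚ t) , ℚ.*-identityˡ _)

take-dualAux : ∀ T j ts → take j (dualAux T ts) ≡ dualAux T (take j ts)
take-dualAux T zero    ts       = refl
take-dualAux T (suc j) []       = refl
take-dualAux T (suc j) (t ∷ ts) = cong (hStep T t ∷_) (take-dualAux (hStep T t) j ts)

take-dual : ∀ j ts → take j (dual ts) ≡ dual (take j ts)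
take-dual zero    ts       = refl
take-dual (suc j) []       = refl
take-dual (suc j) (t ∷ ts) = cong (ℕ→ℚ 2 - ℕ→ℚ t ∷_) (take-dualAux (ℕ→ℚ 2 - ℕ→ℚ t) j ts)

productQ-dual-isInteger : ∀ ts → All (_≢ 0ℚ) (dual ts) → IsInteger (productQ (dual ts))
productQ-dual-isInteger []       _  = isInteger-1
productQ-dual-isInteger (t ∷ ts) nz with integralRatio-dual t ts nz
... | _ , _ , iq , _ = iq

productQ-take-dual-isInteger : ∀ ts → All (_≢ 0ℚ) (dual ts) → ∀ j → IsInteger (productQ (take j (dual ts)))
productQ-take-dual-isInteger ts nz j rewrite take-dual j ts =
  productQ-dual-isInteger (take j ts) (subst (All (_≢ 0ℚ)) (take-dual j ts) (take⁺ j nz))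

-- No hypothesis x ≢ 0ℚ is needed: the junk value inv 0ℚ = 0ℚ is an integer too.
inv-isInteger : ∀ {q x} → IntegralRatio q x → q ≡ 1ℚ ⊎ q ≡ - 1ℚ → IsInteger (inv x)
inv-isInteger {q} {x} (p , ip , _ , px≡q) q≡±1 with x ℚ.≟ 0ℚ
... | yes _   = + 0 , refl
... | no  x≢0 = subst IsInteger inv≡qp (isInteger-* (isInteger-±1 q≡±1) ip)
  where
  instance _ = ℚ.≢-nonZero x≢0
  isInteger-±1 : q ≡ 1ℚ ⊎ q ≡ - 1ℚ → IsInteger q
  isInteger-±1 (inj₁ refl) = isInteger-1
  isInteger-±1 (inj₂ refl) = -[1+ 0 ] , refl
  q*q≡1 : q ≡ 1ℚ ⊎ q ≡ - 1ℚ → q * q ≡ 1ℚ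
  q*q≡1 (inj₁ refl) = refl
  q*q≡1 (inj₂ refl) = refl
  open ≡-Reasoning
  inv≡qp : q * p ≡ 1/ x
  inv≡qp = begin
    q * p                   ≡⟨ cong (q *_) (sym (ℚ.*-identityʳ p)) ⟩
    q * (p * 1ℚ)            ≡⟨ cong (λ y → q * (p * y)) (sym (ℚ.*-inverseʳ x)) ⟩
    q * (p * (x * 1/ x))    ≡⟨ cong (q *_) (sym (ℚ.*-assoc p x (1/ x))) ⟩
    q * ((p * x) * 1/ x)    ≡⟨ cong (λ y → q * (y * 1/ x)) px≡q ⟩
    q * (q * 1/ x)          ≡⟨ sym (ℚ.*-assoc q q (1/ x)) ⟩
    (q * q) * 1/ x          ≡⟨ cong (_* 1/ x) (q*q≡1 q≡±1) ⟩
    1ℚ * 1/ x               ≡⟨ ℚ.*-identityˡ (1/ x) ⟩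
    1/ x                    ∎

hStep-by-negative-inv : ∀ {x} k t → inv x ≡ - ℕ→ℚ (suc k) → hStep x (t ℕ.+ k) ≡ ℕ→ℚ 3 - ℕ→ℚ t
hStep-by-negative-inv {x} k t inv≡ = begin
  (ℕ→ℚ 2 - ℕ→ℚ (t ℕ.+ k)) - inv x                    ≡⟨ cong₂ (λ a b → (ℕ→ℚ 2 - a) - b) (ℕ→ℚ-homo-+ t k) inv≡ ⟩
  (ℕ→ℚ 2 - (ℕ→ℚ t + ℕ→ℚ k)) - - ℕ→ℚ (1 ℕ.+ k)       ≡⟨ cong (λ a → (ℕ→ℚ 2 - (ℕ→ℚ t + ℕ→ℚ k)) - - a) (ℕ→ℚ-homo-+ 1 k) ⟩
  (ℕ→ℚ 2 - (ℕ→ℚ t + ℕ→ℚ k)) - - (ℕ→ℚ 1 + ℕ→ℚ k)   ≡⟨ solve 2 (λ t k → (con (ℕ→ℚ 2) :- (t :+ k)) :- :- (con (ℕ→ℚ 1) :+ k) := con (ℕ→ℚ 3) :- t) refl (ℕ→ℚ t) (ℕ→ℚ k) ⟩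
  ℕ→ℚ 3 - ℕ→ℚ t                                     ∎
  where open ≡-Reasoning; open +-*-Solver

lastQ-dualAux-snoc : ∀ T ts t → lastQ (T ∷ dualAux T (ts ++ t ∷ [])) ≡ hStep (lastQ (T ∷ dualAux T ts)) t
lastQ-dualAux-snoc T []       t = refl
lastQ-dualAux-snoc T (s ∷ ts) t = lastQ-dualAux-snoc (hStep T s) ts t

primitive-snoc : ∀ {s ts t} → Admissible (s ∷ ts) → 1 ℕ.≤ t → hStep (lastQ (dual (s ∷ ts))) t ≡ 0ℚ →
  Primitive ((s ∷ ts) ++ t ∷ [])
primitive-snoc {s} {ts} {t} adm 1≤t h≡0 =
  s ∷ ts , t , refl , 1≤t , adm , trans (lastQ-dualAux-snoc (ℕ→ℚ 2 - ℕ→ℚ s) ts t) h≡0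

theorem5p5 : (ts : List ℕ) → 1 ℕ.≤ length ts → Admissible ts →
    ((j : ℕ) → 1 ℕ.≤ j → j ℕ.≤ length ts → IsInteger (productQ (take j (dual ts))))
    × ((∣ productQ (dual ts) ∣ ≡ 1ℚ → (lastQ (dual ts) ≡ 1ℚ ⊎ lastQ (dual ts) < 0ℚ) →
        ∃ λ (t : ℕ) → 1 ℕ.≤ t × Primitive (ts ++ t ∷ []))
    × ((∣ productQ (dual ts) ∣ ≡ 1ℚ → (lastQ (dual ts) ≡ ½ ⊎ lastQ (dual ts) < 0ℚ) →
        ∃ λ (t : ℕ) → 1 ℕ.≤ t × hStep (lastQ (dual ts)) t ≡ - 1ℚ)
    × (∣ productQ (dual ts) ∣ ≡ 1ℚ → lastQ (dual ts) < 0ℚ →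
        ∃ λ (t : ℕ) → 1 ℕ.≤ t × hStep (lastQ (dual ts)) t ≡ 1ℚ)))
theorem5p5 [] () _
theorem5p5 (s ∷ ts) _ adm@(_ , nz) =
    (λ j _ _ → productQ-take-dual-isInteger (s ∷ ts) nz j)
  , (λ { _ (inj₁ T≡1) → 1 , s≤s z≤n , primitive-snoc adm (s≤s z≤n) (cong (λ y → hStep y 1) T≡1)
       ; ∣P∣≡1 (inj₂ T<0) → let k , e = inv-negative-integer ∣P∣≡1 T<0 in
           3 ℕ.+ k , s≤s z≤n , primitive-snoc adm (s≤s z≤n) (hStep-by-negative-inv {T} k 3 e) })
  , (λ { _ (inj₁ T≡½) → 1 , s≤s z≤n , cong (λ y → hStep y 1) T≡½
       ; ∣P∣≡1 (inj₂ T<0) → let k , e = inv-negative-integer ∣P∣≡1 T<0 in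
           4 ℕ.+ k , s≤s z≤n , hStep-by-negative-inv {T} k 4 e })
  , (λ ∣P∣≡1 T<0 → let k , e = inv-negative-integer ∣P∣≡1 T<0 in
           2 ℕ.+ k , s≤s z≤n , hStep-by-negative-inv {T} k 2 e)
  where
  T : ℚ
  T = lastQ (dual (s ∷ ts))
  inv-negative-integer : ∣ productQ (dual (s ∷ ts)) ∣ ≡ 1ℚ → T < 0ℚ → ∃ λ k → inv T ≡ - ℕ→ℚ (suc k)
  inv-negative-integer ∣P∣≡1 T<0 =
    isInteger-negative (inv-isInteger (integralRatio-dual s ts nz) (∣q∣≡1⇒q≡±1 _ ∣P∣≡1)) (inv-negative T T<0)
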